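{- Let $\mathbf{A}_1,\mathbf{A}_2$ be Stonean residuated lattices and let $(h,k)$ be a morphism in $\mathfrak{T}$ from $(\mathbf{B}(\mathbf{A}_1),\mathbf{D}(\mathbf{A}_1),\phi_{\mathbf{A}_1})$ to $(\mathbf{B}(\mathbf{A}_2),\mathbf{D}(\mathbf{A}_2),\phi_{\mathbf{A}_2})$. Then for all $a\in B(\mathbf{A}_1)$ and $d\in D(\mathbf{A}_1)$, $k(a\vee d)=h(a)\vee k(d)$.
   Context: A residuated lattice is an algebra $(A,\ast,\to,\vee,\wedge,\top)$ with $(A,\ast,\top)$ a commutative monoid, $(A,\vee,\wedge)$ a lattice with top $\top$, and $x\ast y\le z$ iff $x\le y\to z$. A bounded residuated lattice also has a least element $\bot$; $\neg x:=x\to\bot$. Dense elements: $\neg x=\bot$, forming a residuated lattice $\mathbf{D}(\mathbf{A})$ (note $a\vee d$ is dense when $d$ is). Boolean elements: $x\vee\neg x=\top$, $x\wedge\neg x=\bot$, forming a Boolean algebra $\mathbf{B}(\mathbf{A})$. Stonean: bounded residuated lattice satisfying $\neg x\vee\neg\neg x=\top$. i-filters of $\mathbf{D}$: subsets $F\ni\top$ with $x,x\to y\in F\Rightarrow y\in F$; $\mathcal{F}_i(\mathbf{D})$ their lattice under inclusion. $\phi_{\mathbf{A}}(a)=\{x\in D(\mathbf{A}):x\ge\neg a\}$ for $a\in B(\mathbf{A})$. A morphism in $\mathfrak{T}$ from $(\mathbf{B}_1,\mathbf{D}_1,\phi_1)$ to $(\mathbf{B}_2,\mathbf{D}_2,\phi_2)$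 is a pair $(h,k)$ with $h$ a Boolean algebra homomorphism $\mathbf{B}_1\to\mathbf{B}_2$, $k$ a residuated lattice homomorphism $\mathbf{D}_1\to\mathbf{D}_2$, and $k(\phi_1(a))\subseteq\phi_2(h(a))$ for all $a\in B_1$. -}

module Defs where

open import Level using (Level; suc; _⊔_)
open import Data.Product using (Σ; _×_; _,_; proj₁)
open import Relation.Binary.PropositionalEquality using (_≡_)

record BResLattice (c : Level) : Set (suc c) where
  field
    Carrier : Set c
    _∗_ _⇒_ _∨_ _∧_ : Carrier → Carrier → Carrier
    ⊤ ⊥ : Carrier

  infixr 6 _∧_
  infixr 5 _∨_
  infixr 7 _∗_
  infixr 5 _⇒_
  infix 8 ¬_
  infix 4 _≤_

  _≤_ : Carrier → Carrier → Set c
  x ≤ y = x ∧ y ≡ x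

  field
    ∗-assoc    : ∀ x y z → (x ∗ y) ∗ z ≡ x ∗ (y ∗ z)
    ∗-comm     : ∀ x y → x ∗ y ≡ y ∗ x
    ∗-identity : ∀ x → x ∗ ⊤ ≡ x
    ∨-assoc  : ∀ x y z → (x ∨ y) ∨ z ≡ x ∨ (y ∨ z)
    ∧-assoc  : ∀ x y z → (x ∧ y) ∧ z ≡ x ∧ (y ∧ z)
    ∨-comm   : ∀ x y → x ∨ y ≡ y ∨ x
    ∧-comm   : ∀ x y → x ∧ y ≡ y ∧ x
    ∨-absorb : ∀ x y → x ∨ (x ∧ y) ≡ x
    ∧-absorb : ∀ x y → x ∧ (x ∨ y) ≡ x
    ⊤-max : ∀ x → x ≤ ⊤
    ⊥-min : ∀ x → ⊥ ≤ x
    resid-⇒ : ∀ x y z → (x ∗ y) ≤ z → x ≤ (y ⇒ z)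
    resid-⇐ : ∀ x y z → x ≤ (y ⇒ z) → (x ∗ y) ≤ z

  ¬_ : Carrier → Carrier
  ¬ x = x ⇒ ⊥

module _ {c : Level} (A : BResLattice c) where
  open BResLattice A

  IsStonean : Set c
  IsStonean = ∀ x → (¬ x) ∨ (¬ (¬ x)) ≡ ⊤

  IsDense : Carrier → Set c
  IsDense x = ¬ x ≡ ⊥

  IsBoolean : Carrier → Set c
  IsBoolean x = (x ∨ ¬ x ≡ ⊤) × (x ∧ ¬ x ≡ ⊥)

  D : Set c
  D = Σ Carrier IsDense

  B : Set c
  B = Σ Carrier IsBoolean

-- Operations of B(A) and D(A) are those of A restricted; preservation is
-- stated on underlying carrier elements, for every membership proof of the
-- result (membership proofs are unique since K is available).
module _ {c₁ c₂ : Level} (A₁ : BResLattice c₁) (A₂ : BResLattice c₂) where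
  private
    module A₁ = BResLattice A₁
    module A₂ = BResLattice A₂

  record IsBAHom (h : B A₁ → B A₂) : Set (c₁ ⊔ c₂) where
    field
      pres-∨ : ∀ (x y : B A₁) (p : IsBoolean A₁ (proj₁ x A₁.∨ proj₁ y)) →
               proj₁ (h (proj₁ x A₁.∨ proj₁ y , p)) ≡ proj₁ (h x) A₂.∨ proj₁ (h y)
      pres-∧ : ∀ (x y : B A₁) (p : IsBoolean A₁ (proj₁ x A₁.∧ proj₁ y)) →
               proj₁ (h (proj₁ x A₁.∧ proj₁ y , p)) ≡ proj₁ (h x) A₂.∧ proj₁ (h y)
      pres-¬ : ∀ (x : B A₁) (p : IsBoolean A₁ (A₁.¬ proj₁ x)) →
               proj₁ (h (A₁.¬ proj₁ x , p)) ≡ A₂.¬ proj₁ (h x)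
      pres-⊤ : ∀ (p : IsBoolean A₁ A₁.⊤) → proj₁ (h (A₁.⊤ , p)) ≡ A₂.⊤
      pres-⊥ : ∀ (p : IsBoolean A₁ A₁.⊥) → proj₁ (h (A₁.⊥ , p)) ≡ A₂.⊥

  record IsRLHom (k : D A₁ → D A₂) : Set (c₁ ⊔ c₂) where
    field
      pres-∗ : ∀ (x y : D A₁) (p : IsDense A₁ (proj₁ x A₁.∗ proj₁ y)) →
               proj₁ (k (proj₁ x A₁.∗ proj₁ y , p)) ≡ proj₁ (k x) A₂.∗ proj₁ (k y)
      pres-⇒ : ∀ (x y : D A₁) (p : IsDense A₁ (proj₁ x A₁.⇒ proj₁ y)) →
               proj₁ (k (proj₁ x A₁.⇒ proj₁ y , p)) ≡ proj₁ (k x) A₂.⇒ proj₁ (k y)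
      pres-∨ : ∀ (x y : D A₁) (p : IsDense A₁ (proj₁ x A₁.∨ proj₁ y)) →
               proj₁ (k (proj₁ x A₁.∨ proj₁ y , p)) ≡ proj₁ (k x) A₂.∨ proj₁ (k y)
      pres-∧ : ∀ (x y : D A₁) (p : IsDense A₁ (proj₁ x A₁.∧ proj₁ y)) →
               proj₁ (k (proj₁ x A₁.∧ proj₁ y , p)) ≡ proj₁ (k x) A₂.∧ proj₁ (k y)
      pres-⊤ : ∀ (p : IsDense A₁ A₁.⊤) → proj₁ (k (A₁.⊤ , p)) ≡ A₂.⊤

  φ₁ : B A₁ → D A₁ → Set c₁
  φ₁ a x = (A₁.¬ proj₁ a) A₁.≤ proj₁ x

  φ₂ : B A₂ → D A₂ → Set c₂
  φ₂ a x = (A₂.¬ proj₁ a) A₂.≤ proj₁ x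

  record IsTMorphism (h : B A₁ → B A₂) (k : D A₁ → D A₂) : Set (c₁ ⊔ c₂) where
    field
      h-hom : IsBAHom h
      k-hom : IsRLHom k
      φ-compat : ∀ (a : B A₁) (x : D A₁) → φ₁ a x → φ₂ (h a) (k x)

-- The lower bound h a ∨ k d ≤ k (a ∨ d) holds because a = ¬ ¬ a, so every dense
-- x ≥ a lies in φ(¬ a) and hence k x ≥ ¬ h (¬ a) = h a; monotonicity of k gives
-- k d ≤ k (a ∨ d). For the upper bound, ¬ a ≤ (a ∨ d) ⇒ d puts (a ∨ d) ⇒ d in φ(a),
-- so ¬ h a ≤ k (a ∨ d) ⇒ k d, and splitting k (a ∨ d) along the complemented
-- pair h a, ¬ h a yields k (a ∨ d) ≤ h a ∨ k d.
module Submission where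

open import Defs
open import Level using (Level)
open import Data.Product using (_,_; proj₁; proj₂)
open import Relation.Binary.Bundles using (Poset)
open import Relation.Binary.PropositionalEquality
  using (_≡_; refl; sym; trans; cong; subst; isEquivalence)
open import Axiom.UniquenessOfIdentityProofs.WithK using (uip)

module BResLatticeProperties {c : Level} (A : BResLattice c) where
  open BResLattice A

  ∧-idem : ∀ x → x ∧ x ≡ x
  ∧-idem x = trans (cong (x ∧_) (sym (∨-absorb x x))) (∧-absorb x (x ∧ x))

  ≤-reflexive : ∀ {x y} → x ≡ y → x ≤ y
  ≤-reflexive {x} refl = ∧-idem x

  ≤-trans : ∀ {x y z} → x ≤ y → y ≤ z → x ≤ z
  ≤-trans {x} {y} {z} x≤y y≤z =
    trans (cong (_∧ z) (sym x≤y)) (trans (∧-assoc x y z) (trans (cong (x ∧_) y≤z) x≤y))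

  ≤-antisym : ∀ {x y} → x ≤ y → y ≤ x → x ≡ y
  ≤-antisym {x} {y} x≤y y≤x = trans (sym x≤y) (trans (∧-comm x y) y≤x)

  poset : Poset c c c
  poset = record
    { Carrier = Carrier
    ; _≈_ = _≡_
    ; _≤_ = _≤_
    ; isPartialOrder = record
      { isPreorder = record
        { isEquivalence = isEquivalence
        ; reflexive = ≤-reflexive
        ; trans = ≤-trans
        }
      ; antisym = ≤-antisym
      }
    }

  open import Relation.Binary.Reasoning.PartialOrder poset

  x≤x∨y : ∀ x y → x ≤ x ∨ y
  x≤x∨y = ∧-absorb

  y≤x∨y : ∀ x y → y ≤ x ∨ y
  y≤x∨y x y = subst (y ≤_) (∨-comm y x) (∧-absorb y x)

  ≤⇒∨≡ : ∀ {x y} → x ≤ y → x ∨ y ≡ y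
  ≤⇒∨≡ {x} {y} x≤y = begin-equality
    x ∨ y        ≡⟨ cong (_∨ y) x≤y ⟨
    (x ∧ y) ∨ y  ≡⟨ ∨-comm (x ∧ y) y ⟩
    y ∨ (x ∧ y)  ≡⟨ cong (y ∨_) (∧-comm x y) ⟩
    y ∨ (y ∧ x)  ≡⟨ ∨-absorb y x ⟩
    y            ∎

  ∨-lub : ∀ {x y z} → x ≤ z → y ≤ z → x ∨ y ≤ z
  ∨-lub {x} {y} {z} x≤z y≤z = trans (cong ((x ∨ y) ∧_) (sym x∨y∨z≡z)) (∧-absorb (x ∨ y) z)
    where
    x∨y∨z≡z : (x ∨ y) ∨ z ≡ z
    x∨y∨z≡z = trans (∨-assoc x y z) (trans (cong (x ∨_) (≤⇒∨≡ y≤z)) (≤⇒∨≡ x≤z))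

  ∨-mono-≤ : ∀ {x x′ y y′} → x ≤ x′ → y ≤ y′ → x ∨ y ≤ x′ ∨ y′
  ∨-mono-≤ {x′ = x′} {y′ = y′} x≤x′ y≤y′ =
    ∨-lub (≤-trans x≤x′ (x≤x∨y x′ y′)) (≤-trans y≤y′ (y≤x∨y x′ y′))

  ∗-monoˡ-≤ : ∀ {x y} z → x ≤ y → x ∗ z ≤ y ∗ z
  ∗-monoˡ-≤ {x} {y} z x≤y =
    resid-⇐ x z (y ∗ z) (≤-trans x≤y (resid-⇒ y z (y ∗ z) (≤-reflexive refl)))

  ∗-identityˡ : ∀ x → ⊤ ∗ x ≡ x
  ∗-identityˡ x = trans (∗-comm ⊤ x) (∗-identity x)

  x∗y≤y : ∀ x y → x ∗ y ≤ y
  x∗y≤y x y = subst (x ∗ y ≤_) (∗-identityˡ y) (∗-monoˡ-≤ y (⊤-max x))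

  x∗y≤x : ∀ x y → x ∗ y ≤ x
  x∗y≤x x y = subst (_≤ x) (∗-comm y x) (x∗y≤y y x)

  ∗-distribʳ-∨ : ∀ x y z → (y ∨ z) ∗ x ≡ y ∗ x ∨ z ∗ x
  ∗-distribʳ-∨ x y z = ≤-antisym
    (resid-⇐ (y ∨ z) x _ (∨-lub (resid-⇒ y x _ (x≤x∨y (y ∗ x) (z ∗ x)))
                                (resid-⇒ z x _ (y≤x∨y (y ∗ x) (z ∗ x)))))
    (∨-lub (∗-monoˡ-≤ x (x≤x∨y y z)) (∗-monoˡ-≤ x (y≤x∨y y z)))

  ¬x∗x≤⊥ : ∀ x → ¬ x ∗ x ≤ ⊥
  ¬x∗x≤⊥ x = resid-⇐ (¬ x) x ⊥ (≤-reflexive refl)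

  x∗¬x≤⊥ : ∀ x → x ∗ ¬ x ≤ ⊥
  x∗¬x≤⊥ x = subst (_≤ ⊥) (∗-comm (¬ x) x) (¬x∗x≤⊥ x)

  ¬-antitone : ∀ {x y} → x ≤ y → ¬ y ≤ ¬ x
  ¬-antitone {x} {y} x≤y = resid-⇒ (¬ y) x ⊥ (begin
    ¬ y ∗ x  ≡⟨ ∗-comm (¬ y) x ⟩
    x ∗ ¬ y  ≤⟨ ∗-monoˡ-≤ (¬ y) x≤y ⟩
    y ∗ ¬ y  ≤⟨ x∗¬x≤⊥ y ⟩
    ⊥        ∎)

  ¬-∗-∨-≤ : ∀ x y → ¬ x ∗ (x ∨ y) ≤ y
  ¬-∗-∨-≤ x y = begin
    ¬ x ∗ (x ∨ y)          ≡⟨ ∗-comm (¬ x) (x ∨ y) ⟩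
    (x ∨ y) ∗ ¬ x          ≡⟨ ∗-distribʳ-∨ (¬ x) x y ⟩
    x ∗ ¬ x ∨ y ∗ ¬ x      ≤⟨ ∨-lub (≤-trans (x∗¬x≤⊥ x) (⊥-min y)) (x∗y≤x y (¬ x)) ⟩
    y                      ∎

  dense-mono : ∀ {x y} → x ≤ y → IsDense A x → IsDense A y
  dense-mono {x} {y} x≤y ¬x≡⊥ = ≤-antisym (subst (¬ y ≤_) ¬x≡⊥ (¬-antitone x≤y)) (⊥-min (¬ y))

  ⇒-dense : ∀ x {y} → IsDense A y → IsDense A (x ⇒ y)
  ⇒-dense x {y} = dense-mono (resid-⇒ y x y (x∗y≤x y x))

  ∗-¬-≤⇒≤-∨ : ∀ {b x y} → b ∨ ¬ b ≡ ⊤ → x ∗ ¬ b ≤ y → x ≤ b ∨ y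
  ∗-¬-≤⇒≤-∨ {b} {x} {y} b∨¬b≡⊤ x∗¬b≤y = begin
    x                      ≡⟨ ∗-identity x ⟨
    x ∗ ⊤                  ≡⟨ cong (x ∗_) b∨¬b≡⊤ ⟨
    x ∗ (b ∨ ¬ b)          ≡⟨ ∗-comm x (b ∨ ¬ b) ⟩
    (b ∨ ¬ b) ∗ x          ≡⟨ ∗-distribʳ-∨ x b (¬ b) ⟩
    b ∗ x ∨ ¬ b ∗ x        ≤⟨ ∨-mono-≤ (x∗y≤x b x) (≤-trans (≤-reflexive (∗-comm (¬ b) x)) x∗¬b≤y) ⟩
    b ∨ y                  ∎

  ¬¬-boolean : ∀ {b} → b ∨ ¬ b ≡ ⊤ → ¬ ¬ b ≡ b
  ¬¬-boolean {b} b∨¬b≡⊤ = ≤-antisym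
    (≤-trans (∗-¬-≤⇒≤-∨ b∨¬b≡⊤ (¬x∗x≤⊥ (¬ b))) (∨-lub (≤-reflexive refl) (⊥-min b)))
    (resid-⇒ b (¬ b) ⊥ (x∗¬x≤⊥ b))

  ¬-boolean : ∀ {b} → IsBoolean A b → IsBoolean A (¬ b)
  ¬-boolean {b} (b∨¬b≡⊤ , b∧¬b≡⊥) =
      trans (cong (¬ b ∨_) ¬¬b≡b) (trans (∨-comm (¬ b) b) b∨¬b≡⊤)
    , trans (cong (¬ b ∧_) ¬¬b≡b) (trans (∧-comm (¬ b) b) b∧¬b≡⊥)
    where
    ¬¬b≡b : ¬ ¬ b ≡ b
    ¬¬b≡b = ¬¬-boolean b∨¬b≡⊤

module TMorphismProperties {c₁ c₂ : Level} {A₁ : BResLattice c₁} {A₂ : BResLattice c₂}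
  {h : B A₁ → B A₂} {k : D A₁ → D A₂} (T : IsTMorphism A₁ A₂ h k) where
  private
    module A₁ = BResLattice A₁
    module A₂ = BResLattice A₂
    module P₁ = BResLatticeProperties A₁
    module P₂ = BResLatticeProperties A₂
    module H = IsBAHom (IsTMorphism.h-hom T)
    module K = IsRLHom (IsTMorphism.k-hom T)
  open IsTMorphism T using (φ-compat)

  k-cong : ∀ {x y} → x ≡ y → (px : IsDense A₁ x) (py : IsDense A₁ y) →
           proj₁ (k (x , px)) ≡ proj₁ (k (y , py))
  k-cong refl px py = cong (λ p → proj₁ (k (_ , p))) (uip px py)

  k-mono : ∀ (x y : D A₁) → proj₁ x A₁.≤ proj₁ y → proj₁ (k x) A₂.≤ proj₁ (k y)
  k-mono (x , px) (y , py) x≤y =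
    trans (sym (K.pres-∧ (x , px) (y , py) px∧y)) (k-cong x≤y px∧y px)
    where
    px∧y : IsDense A₁ (x A₁.∧ y)
    px∧y = subst (IsDense A₁) (sym x≤y) px

  h≤k : ∀ (a : B A₁) (x : D A₁) → proj₁ a A₁.≤ proj₁ x → proj₁ (h a) A₂.≤ proj₁ (k x)
  h≤k (a , a-bool) x a≤x = subst (A₂._≤ proj₁ (k x)) ¬h¬a≡ha
    (φ-compat (A₁.¬ a , ¬a-bool) x (subst (A₁._≤ proj₁ x) (sym (P₁.¬¬-boolean (proj₁ a-bool))) a≤x))
    where
    ¬a-bool : IsBoolean A₁ (A₁.¬ a)
    ¬a-bool = P₁.¬-boolean a-bool
    ¬h¬a≡ha : A₂.¬ proj₁ (h (A₁.¬ a , ¬a-bool)) ≡ proj₁ (h (a , a-bool))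
    ¬h¬a≡ha = trans (cong A₂.¬_ (H.pres-¬ (a , a-bool) ¬a-bool))
                    (P₂.¬¬-boolean (proj₁ (proj₂ (h (a , a-bool)))))

  k≤h∨k : ∀ (a : B A₁) (x y : D A₁) → A₁.¬ proj₁ a A₁.∗ proj₁ x A₁.≤ proj₁ y →
          proj₁ (k x) A₂.≤ proj₁ (h a) A₂.∨ proj₁ (k y)
  k≤h∨k a (x , px) (y , py) ¬a∗x≤y = P₂.∗-¬-≤⇒≤-∨ (proj₁ (proj₂ (h a)))
    (subst (A₂._≤ ky) (A₂.∗-comm (A₂.¬ ha) kx) (A₂.resid-⇐ (A₂.¬ ha) kx ky ¬ha≤kx⇒ky))
    where
    ha kx ky : A₂.Carrier
    ha = proj₁ (h a)
    kx = proj₁ (k (x , px))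
    ky = proj₁ (k (y , py))
    px⇒y : IsDense A₁ (x A₁.⇒ y)
    px⇒y = P₁.⇒-dense x py
    ¬ha≤kx⇒ky : A₂.¬ ha A₂.≤ kx A₂.⇒ ky
    ¬ha≤kx⇒ky = subst (A₂.¬ ha A₂.≤_) (K.pres-⇒ (x , px) (y , py) px⇒y)
      (φ-compat a (x A₁.⇒ y , px⇒y) (A₁.resid-⇒ (A₁.¬ proj₁ a) x y ¬a∗x≤y))

lemma3p9 : ∀ {c₁ c₂ : Level} (A₁ : BResLattice c₁) (A₂ : BResLattice c₂) →
    IsStonean A₁ → IsStonean A₂ →
    (h : B A₁ → B A₂) (k : D A₁ → D A₂) → IsTMorphism A₁ A₂ h k →
    ∀ (a : B A₁) (d : D A₁) (p : IsDense A₁ (BResLattice._∨_ A₁ (proj₁ a) (proj₁ d))) →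
    proj₁ (k (BResLattice._∨_ A₁ (proj₁ a) (proj₁ d) , p))
    ≡ BResLattice._∨_ A₂ (proj₁ (h a)) (proj₁ (k d))
lemma3p9 A₁ A₂ _ _ h k T a d p = P₂.≤-antisym
  (k≤h∨k a a∨d d (P₁.¬-∗-∨-≤ (proj₁ a) (proj₁ d)))
  (P₂.∨-lub (h≤k a a∨d (P₁.x≤x∨y (proj₁ a) (proj₁ d)))
            (k-mono d a∨d (P₁.y≤x∨y (proj₁ a) (proj₁ d))))
  where
  module P₁ = BResLatticeProperties A₁
  module P₂ = BResLatticeProperties A₂
  open TMorphismProperties T
  a∨d : D A₁
  a∨d = BResLattice._∨_ A₁ (proj₁ a) (proj₁ d) , p
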